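{- The star combinatory calculus for arithmetic has the Church–Rosser property: each term has a unique normal form.
   Context: Star combinatory calculus for arithmetic: types are generated from the ground type $N$ by $\sigma\to\tau$ and $\sigma^*$. Constants: $0:N$, $S:N\to N$, $R_\sigma:N\to\sigma\to(\sigma\to N\to\sigma)\to\sigma$; $\Pi_{\sigma,\tau}:\sigma\to\tau\to\sigma$; $\Sigma_{\rho,\sigma,\tau}:(\rho\to\sigma\to\tau)\to(\rho\to\sigma)\to\rho\to\tau$; $\mathfrak{s}_\sigma:\sigma\to\sigma^*$; $\cup_\sigma:\sigma^*\to\sigma^*\to\sigma^*$; $\bigcup_{\sigma,\tau}:\sigma^*\to(\sigma\to\tau^*)\to\tau^*$. Terms: constants, typed variables, applications. Conversions: $\Sigma tqr\rightsquigarrow tr(qr)$; $\Pi tq\rightsquigarrow t$; $\bigcup(\mathfrak{s}t)q\rightsquigarrow qt$; $\bigcup(\cup tq)r\rightsquigarrow\cup(\bigcup tr)(\bigcup qr)$; $R0qr\rightsquigarrow q$; $R(St)qr\rightsquigarrow r(Rtqr)t$. A one-step reduction replaces a subterm by its converse according to one conversion; reduction is a finite chain of one-step reductions. A term is normal if no one-step reduction applies to it; a normal form of $t$ is a normal term obtained from $t$ by reduction. -}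

module Defs where

open import Data.Nat using (ℕ)
open import Data.Product using (Σ; _×_; ∃)
open import Relation.Nullary using (¬_)
open import Relation.Binary.PropositionalEquality using (_≡_)
open import Relation.Binary.Construct.Closure.ReflexiveTransitive using (Star)

infixr 5 _⇒_
data Ty : Set where
  N   : Ty
  _⇒_ : Ty → Ty → Ty
  _*  : Ty → Ty

infixl 9 _·_
data Tm : Ty → Set where
  var    : (σ : Ty) → ℕ → Tm σ
  𝟘      : Tm N
  𝐒      : Tm (N ⇒ N)
  𝐑      : (σ : Ty) → Tm (N ⇒ σ ⇒ (σ ⇒ N ⇒ σ) ⇒ σ)
  𝚷      : (σ τ : Ty) → Tm (σ ⇒ τ ⇒ σ)
  𝚺      : (ρ σ τ : Ty) → Tm ((ρ ⇒ σ ⇒ τ) ⇒ (ρ ⇒ σ) ⇒ ρ ⇒ τ)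
  𝔰      : (σ : Ty) → Tm (σ ⇒ σ *)
  ∪      : (σ : Ty) → Tm (σ * ⇒ σ * ⇒ σ *)
  ⋃      : (σ τ : Ty) → Tm (σ * ⇒ (σ ⇒ τ *) ⇒ τ *)
  _·_    : {σ τ : Ty} → Tm (σ ⇒ τ) → Tm σ → Tm τ

infix 4 _⇝_
data _⇝_ : {σ : Ty} → Tm σ → Tm σ → Set where
  conv-Σ  : ∀ {ρ σ τ} (t : Tm (ρ ⇒ σ ⇒ τ)) (q : Tm (ρ ⇒ σ)) (r : Tm ρ) →
            𝚺 ρ σ τ · t · q · r ⇝ t · r · (q · r)
  conv-Π  : ∀ {σ τ} (t : Tm σ) (q : Tm τ) → 𝚷 σ τ · t · q ⇝ t
  conv-⋃s : ∀ {σ τ} (t : Tm σ) (q : Tm (σ ⇒ τ *)) →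
            ⋃ σ τ · (𝔰 σ · t) · q ⇝ q · t
  conv-⋃∪ : ∀ {σ τ} (t q : Tm (σ *)) (r : Tm (σ ⇒ τ *)) →
            ⋃ σ τ · (∪ σ · t · q) · r ⇝ ∪ τ · (⋃ σ τ · t · r) · (⋃ σ τ · q · r)
  conv-R0 : ∀ {σ} (q : Tm σ) (r : Tm (σ ⇒ N ⇒ σ)) → 𝐑 σ · 𝟘 · q · r ⇝ q
  conv-RS : ∀ {σ} (t : Tm N) (q : Tm σ) (r : Tm (σ ⇒ N ⇒ σ)) →
            𝐑 σ · (𝐒 · t) · q · r ⇝ r · (𝐑 σ · t · q · r) · t

infix 4 _⟶_
data _⟶_ : {σ : Ty} → Tm σ → Tm σ → Set where
  here  : ∀ {σ} {t u : Tm σ} → t ⇝ u → t ⟶ u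
  appˡ  : ∀ {σ τ} {f f' : Tm (σ ⇒ τ)} (a : Tm σ) → f ⟶ f' → f · a ⟶ f' · a
  appʳ  : ∀ {σ τ} (f : Tm (σ ⇒ τ)) {a a' : Tm σ} → a ⟶ a' → f · a ⟶ f · a'

infix 4 _⟶*_
_⟶*_ : {σ : Ty} → Tm σ → Tm σ → Set
_⟶*_ = Star _⟶_

Normal : {σ : Ty} → Tm σ → Set
Normal t = ∀ u → ¬ (t ⟶ u)

IsNormalFormOf : {σ : Ty} → Tm σ → Tm σ → Set
IsNormalFormOf n t = (t ⟶* n) × Normal n

{-# OPTIONS --safe #-}

-- Weak normalisation is proved by a Tait-style computability predicate. At N and σ* it is
-- inductive, mirroring the recursion of R on numerals and of ⋃ on finite sets built from 𝔰
-- and ∪; at σ → τ it is the usual logical relation. Confluence is proved à la Tait and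
-- Martin-Löf: parallel reduction has the diamond property and lies between one-step
-- reduction and its reflexive-transitive closure. A normal term has no reducts, so two
-- normal forms of one term meet only if they are equal.
module Submission where

open import Defs
open import Level using (Level)
open import Data.Product using (Σ; ∃; _×_; _,_; proj₁; proj₂)
open import Relation.Nullary using (¬_; contradiction)
open import Relation.Binary.Core using (Rel)
open import Relation.Binary.PropositionalEquality using (_≡_; refl; sym; trans)
open import Relation.Binary.Construct.Closure.ReflexiveTransitive
  using (Star; ε; _◅_; _◅◅_; gmap; map; _⋆)
open import Relation.Binary.Rewriting using (Confluent)

variable
  ρ σ τ : Ty

module _ {ℓ₁ ℓ₂ : Level} {A : Set ℓ₁} where

  diamond⇒confluent : {_▷_ : Rel A ℓ₂} →
    (∀ {x y z} → x ▷ y → x ▷ z → ∃ λ w → y ▷ w × z ▷ w) → Confluent _▷_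
  diamond⇒confluent {_▷_} diamond = confluent
    where
    strip : ∀ {x y z} → x ▷ y → Star _▷_ x z → ∃ λ w → Star _▷_ y w × z ▷ w
    strip x▷y ε = _ , ε , x▷y
    strip x▷y (x▷z ◅ z▷*v) =
      let (w , y▷w , z▷w) = diamond x▷y x▷z
          (w' , w▷*w' , v▷w') = strip z▷w z▷*v
      in w' , y▷w ◅ w▷*w' , v▷w'

    confluent : Confluent _▷_
    confluent ε x▷*z = _ , x▷*z , ε
    confluent (x▷y ◅ y▷*v) x▷*z =
      let (w , y▷*w , z▷w) = strip x▷y x▷*z
          (w' , v▷*w' , w▷*w') = confluent y▷*v y▷*w
      in w' , v▷*w' , z▷w ◅ w▷*w'

  sandwiched-confluent : {_▷_ _▶_ : Rel A ℓ₂} →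
    (∀ {x y} → x ▷ y → x ▶ y) → (∀ {x y} → x ▶ y → Star _▷_ x y) →
    Confluent _▶_ → Confluent _▷_
  sandwiched-confluent ▷⇒▶ ▶⇒▷* confluent x▷*y x▷*z =
    let (w , y▶*w , z▶*w) = confluent (map ▷⇒▶ x▷*y) (map ▷⇒▶ x▷*z)
    in w , (▶⇒▷* ⋆) y▶*w , (▶⇒▷* ⋆) z▶*w

variable
  f f' : Tm (σ ⇒ τ)
  a a' s t t' u v n w n₁ n₂ : Tm σ

·-congˡ : (a : Tm σ) → f ⟶* f' → f · a ⟶* f' · a
·-congˡ a = gmap (_· a) (appˡ a)

·-congʳ : (f : Tm (σ ⇒ τ)) → a ⟶* a' → f · a ⟶* f · a'
·-congʳ f = gmap (f ·_) (appʳ f)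

·-cong : f ⟶* f' → a ⟶* a' → f · a ⟶* f' · a'
·-cong {f' = f'} {a = a} f⟶*f' a⟶*a' = ·-congˡ a f⟶*f' ◅◅ ·-congʳ f' a⟶*a'

contract : t ⇝ u → t ⟶* u
contract c = here c ◅ ε

data Ne : Tm σ → Set
data Nf : Tm σ → Set

data Ne where
  ne-var : ∀ {x} → Ne (var σ x)
  ne-·   : Ne f → Nf a → Ne (f · a)
  ne-𝐑   : {q : Tm σ} {r : Tm (σ ⇒ N ⇒ σ)} → Ne s → Nf q → Nf r → Ne (𝐑 σ · s · q · r)
  ne-⋃   : {q : Tm (σ ⇒ τ *)} → Ne s → Nf q → Ne (⋃ σ τ · s · q)

data Nf where
  nf-ne : Ne t → Nf t
  nf-𝟘  : Nf 𝟘
  nf-𝐒  : Nf 𝐒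
  nf-𝐒₁ : Nf a → Nf (𝐒 · a)
  nf-𝐑  : Nf (𝐑 σ)
  nf-𝐑₁ : Nf a → Nf (𝐑 σ · a)
  nf-𝐑₂ : {b : Tm σ} → Nf a → Nf b → Nf (𝐑 σ · a · b)
  nf-𝚷  : Nf (𝚷 σ τ)
  nf-𝚷₁ : {a : Tm σ} → Nf a → Nf (𝚷 σ τ · a)
  nf-𝚺  : Nf (𝚺 ρ σ τ)
  nf-𝚺₁ : {a : Tm (ρ ⇒ σ ⇒ τ)} → Nf a → Nf (𝚺 ρ σ τ · a)
  nf-𝚺₂ : {a : Tm (ρ ⇒ σ ⇒ τ)} {b : Tm (ρ ⇒ σ)} → Nf a → Nf b → Nf (𝚺 ρ σ τ · a · b)
  nf-𝔰  : Nf (𝔰 σ)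
  nf-𝔰₁ : {a : Tm σ} → Nf a → Nf (𝔰 σ · a)
  nf-∪  : Nf (∪ σ)
  nf-∪₁ : {a : Tm (σ *)} → Nf a → Nf (∪ σ · a)
  nf-∪₂ : {a b : Tm (σ *)} → Nf a → Nf b → Nf (∪ σ · a · b)
  nf-⋃  : Nf (⋃ σ τ)
  nf-⋃₁ : {a : Tm (σ *)} → Nf a → Nf (⋃ σ τ · a)

·-normal : Normal f → Normal a → (∀ {u} → ¬ (f · a ⇝ u)) → Normal (f · a)
·-normal _        _        stuck _ (here c)   = stuck c
·-normal f-normal _        _     _ (appˡ _ s) = f-normal _ s
·-normal _        a-normal _     _ (appʳ _ s) = a-normal _ s

ne-·-stuck : Ne f → ¬ (f · a ⇝ u)
ne-·-stuck (ne-· (ne-· () _) _) (conv-Σ _ _ _)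
ne-·-stuck (ne-· (ne-· () _) _) (conv-R0 _ _)
ne-·-stuck (ne-· (ne-· () _) _) (conv-RS _ _ _)

ne-𝐑-stuck : {q : Tm σ} {r : Tm (σ ⇒ N ⇒ σ)} → Ne s → ¬ (𝐑 σ · s · q · r ⇝ u)
ne-𝐑-stuck () (conv-R0 _ _)
ne-𝐑-stuck (ne-· () _) (conv-RS _ _ _)

ne-⋃-stuck : {q : Tm (σ ⇒ τ *)} → Ne s → ¬ (⋃ σ τ · s · q ⇝ u)
ne-⋃-stuck (ne-· () _) (conv-⋃s _ _)
ne-⋃-stuck (ne-· (ne-· () _) _) (conv-⋃∪ _ _ _)

ne-normal : Ne t → Normal t
nf-normal : Nf t → Normal t

ne-normal ne-var _ (here ())
ne-normal (ne-· f a)   = ·-normal (ne-normal f) (nf-normal a) (ne-·-stuck f)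
ne-normal (ne-𝐑 s q r) = ·-normal (nf-normal (nf-𝐑₂ (nf-ne s) q)) (nf-normal r) (ne-𝐑-stuck s)
ne-normal (ne-⋃ s q)   = ·-normal (nf-normal (nf-⋃₁ (nf-ne s))) (nf-normal q) (ne-⋃-stuck s)

nf-normal (nf-ne t)   = ne-normal t
nf-normal nf-𝟘 _ (here ())
nf-normal nf-𝐒 _ (here ())
nf-normal (nf-𝐒₁ a)   = ·-normal (nf-normal nf-𝐒) (nf-normal a) λ ()
nf-normal nf-𝐑 _ (here ())
nf-normal (nf-𝐑₁ a)   = ·-normal (nf-normal nf-𝐑) (nf-normal a) λ ()
nf-normal (nf-𝐑₂ a b) = ·-normal (nf-normal (nf-𝐑₁ a)) (nf-normal b) λ ()
nf-normal nf-𝚷 _ (here ())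
nf-normal (nf-𝚷₁ a)   = ·-normal (nf-normal nf-𝚷) (nf-normal a) λ ()
nf-normal nf-𝚺 _ (here ())
nf-normal (nf-𝚺₁ a)   = ·-normal (nf-normal nf-𝚺) (nf-normal a) λ ()
nf-normal (nf-𝚺₂ a b) = ·-normal (nf-normal (nf-𝚺₁ a)) (nf-normal b) λ ()
nf-normal nf-𝔰 _ (here ())
nf-normal (nf-𝔰₁ a)   = ·-normal (nf-normal nf-𝔰) (nf-normal a) λ ()
nf-normal nf-∪ _ (here ())
nf-normal (nf-∪₁ a)   = ·-normal (nf-normal nf-∪) (nf-normal a) λ ()
nf-normal (nf-∪₂ a b) = ·-normal (nf-normal (nf-∪₁ a)) (nf-normal b) λ ()
nf-normal nf-⋃ _ (here ())
nf-normal (nf-⋃₁ a)   = ·-normal (nf-normal nf-⋃) (nf-normal a) λ ()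

HasNf : Tm σ → Set
HasNf {σ} t = Σ (Tm σ) λ n → t ⟶* n × Nf n

nf⇒hasNf : Nf t → HasNf t
nf⇒hasNf n = _ , ε , n

hasNf-expand : t ⟶* t' → HasNf t' → HasNf t
hasNf-expand r (n , r' , nf) = n , r ◅◅ r' , nf

hasNf-·₁ : (∀ {a'} → Nf a' → Nf (f · a')) → HasNf a → HasNf (f · a)
hasNf-·₁ {f = f} nf-f· (a' , r , nf) = f · a' , ·-congʳ f r , nf-f· nf

hasNf-·₂ : {g : Tm (ρ ⇒ σ ⇒ τ)} {a : Tm ρ} {b : Tm σ} →
  (∀ {a' b'} → Nf a' → Nf b' → Nf (g · a' · b')) → HasNf a → HasNf b → HasNf (g · a · b)
hasNf-·₂ {g = g} nf-g·· (a' , ra , nfa) (b' , rb , nfb) =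
  g · a' · b' , ·-cong (·-congʳ g ra) rb , nf-g·· nfa nfb

data ComputableNat : Tm N → Set where
  zero    : t ⟶* 𝟘 → ComputableNat t
  suc     : t ⟶* 𝐒 · a → ComputableNat a → ComputableNat t
  neutral : t ⟶* s → Ne s → ComputableNat t

data ComputableSet {σ} (P : Tm σ → Set) : Tm (σ *) → Set where
  singleton : t ⟶* 𝔰 σ · a → P a → ComputableSet P t
  union     : {a b : Tm (σ *)} →
              t ⟶* ∪ σ · a · b → ComputableSet P a → ComputableSet P b → ComputableSet P t
  neutral   : t ⟶* s → Ne s → ComputableSet P t

-- Normalisability is built into the arrow case: a normal form of t · x does not directly
-- yield one of t.
Computable : (σ : Ty) → Tm σ → Set
Computable N         = ComputableNat
Computable (σ ⇒ τ) t = HasNf t × (∀ u → Computable σ u → Computable τ (t · u))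
Computable (σ *)     = ComputableSet (Computable σ)

computable-· : Computable (σ ⇒ τ) f → Computable σ a → Computable τ (f · a)
computable-· cf ca = proj₂ cf _ ca

reify-nat : ComputableNat t → HasNf t
reify-nat (zero r)      = hasNf-expand r (nf⇒hasNf nf-𝟘)
reify-nat (suc r a)     = hasNf-expand r (hasNf-·₁ nf-𝐒₁ (reify-nat a))
reify-nat (neutral r s) = hasNf-expand r (nf⇒hasNf (nf-ne s))

reify-set : {P : Tm σ → Set} → (∀ {a} → P a → HasNf a) → ComputableSet P t → HasNf t
reify-set reify-P (singleton r a) = hasNf-expand r (hasNf-·₁ nf-𝔰₁ (reify-P a))
reify-set reify-P (union r a b)   =
  hasNf-expand r (hasNf-·₂ nf-∪₂ (reify-set reify-P a) (reify-set reify-P b))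
reify-set reify-P (neutral r s)   = hasNf-expand r (nf⇒hasNf (nf-ne s))

reify : (σ : Ty) {t : Tm σ} → Computable σ t → HasNf t
reify N       = reify-nat
reify (σ ⇒ τ) = proj₁
reify (σ *)   = reify-set (reify σ)

reflect : (σ : Ty) {t s : Tm σ} → t ⟶* s → Ne s → Computable σ t
reflect N       = neutral
reflect (σ *)   = neutral
reflect (σ ⇒ τ) r s = hasNf-expand r (nf⇒hasNf (nf-ne s)) , λ u cu →
  let (_ , ru , nu) = reify σ cu in reflect τ (·-cong r ru) (ne-· s nu)

computable-expand : (σ : Ty) {t t' : Tm σ} → t ⟶* t' → Computable σ t' → Computable σ t
computable-expand N     r (zero r')        = zero (r ◅◅ r')
computable-expand N     r (suc r' a)       = suc (r ◅◅ r') a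
computable-expand N     r (neutral r' s)   = neutral (r ◅◅ r') s
computable-expand (σ *) r (singleton r' a) = singleton (r ◅◅ r') a
computable-expand (σ *) r (union r' a b)   = union (r ◅◅ r') a b
computable-expand (σ *) r (neutral r' s)   = neutral (r ◅◅ r') s
computable-expand (σ ⇒ τ) r (h , ct) =
  hasNf-expand r h , λ u cu → computable-expand τ (·-congˡ u r) (ct u cu)

𝐒-computable : Computable (N ⇒ N) 𝐒
𝐒-computable = nf⇒hasNf nf-𝐒 , λ _ → suc ε

𝚷-computable : Computable (σ ⇒ τ ⇒ σ) (𝚷 σ τ)
𝚷-computable {σ} = nf⇒hasNf nf-𝚷 , λ t ct →
  hasNf-·₁ nf-𝚷₁ (reify σ ct) , λ q _ →
  computable-expand σ (contract (conv-Π t q)) ct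

𝚺-computable : Computable ((ρ ⇒ σ ⇒ τ) ⇒ (ρ ⇒ σ) ⇒ ρ ⇒ τ) (𝚺 ρ σ τ)
𝚺-computable {τ = τ} = nf⇒hasNf nf-𝚺 , λ t ct →
  hasNf-·₁ nf-𝚺₁ (reify _ ct) , λ q cq →
  hasNf-·₂ nf-𝚺₂ (reify _ ct) (reify _ cq) , λ r cr →
  computable-expand τ (contract (conv-Σ t q r)) (computable-· (computable-· ct cr) (computable-· cq cr))

𝔰-computable : Computable (σ ⇒ σ *) (𝔰 σ)
𝔰-computable = nf⇒hasNf nf-𝔰 , λ _ → singleton ε

∪-computable : Computable (σ * ⇒ σ * ⇒ σ *) (∪ σ)
∪-computable {σ} = nf⇒hasNf nf-∪ , λ _ ca →
  hasNf-·₁ nf-∪₁ (reify (σ *) ca) , λ _ → union ε ca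

⋃-computable-· : ComputableSet (Computable σ) s → (q : Tm (σ ⇒ τ *)) →
  Computable (σ ⇒ τ *) q → Computable (τ *) (⋃ σ τ · s · q)
⋃-computable-· {σ = σ} {τ = τ} (singleton r a) q cq =
  computable-expand (τ *) (·-congˡ q (·-congʳ (⋃ σ τ) r) ◅◅ contract (conv-⋃s _ q)) (computable-· cq a)
⋃-computable-· {σ = σ} {τ = τ} (union r a b) q cq =
  union (·-congˡ q (·-congʳ (⋃ σ τ) r) ◅◅ contract (conv-⋃∪ _ _ q))
        (⋃-computable-· a q cq) (⋃-computable-· b q cq)
⋃-computable-· {σ = σ} {τ = τ} (neutral r s) q ((_ , rq , nq) , _) =
  neutral (·-cong (·-congʳ (⋃ σ τ) r) rq) (ne-⋃ s nq)

⋃-computable : Computable (σ * ⇒ (σ ⇒ τ *) ⇒ τ *) (⋃ σ τ)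
⋃-computable {σ} = nf⇒hasNf nf-⋃ , λ _ cs →
  hasNf-·₁ nf-⋃₁ (reify (σ *) cs) , ⋃-computable-· cs

𝐑-computable-· : ComputableNat s → (q : Tm σ) → Computable σ q →
  (r : Tm (σ ⇒ N ⇒ σ)) → Computable (σ ⇒ N ⇒ σ) r → Computable σ (𝐑 σ · s · q · r)
𝐑-computable-· {σ = σ} (zero s⟶*𝟘) q cq r _ =
  computable-expand σ (·-congˡ r (·-congˡ q (·-congʳ (𝐑 σ) s⟶*𝟘)) ◅◅ contract (conv-R0 q r)) cq
𝐑-computable-· {σ = σ} (suc s⟶*𝐒a ca) q cq r cr =
  computable-expand σ (·-congˡ r (·-congˡ q (·-congʳ (𝐑 σ) s⟶*𝐒a)) ◅◅ contract (conv-RS _ q r))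
    (computable-· (computable-· cr (𝐑-computable-· ca q cq r cr)) ca)
𝐑-computable-· {σ = σ} (neutral s⟶*s' s') q cq r ((_ , rr , nr) , _) =
  let (_ , rq , nq) = reify σ cq
  in reflect σ (·-cong (·-cong (·-congʳ (𝐑 σ) s⟶*s') rq) rr) (ne-𝐑 s' nq nr)

𝐑-computable : Computable (N ⇒ σ ⇒ (σ ⇒ N ⇒ σ) ⇒ σ) (𝐑 σ)
𝐑-computable {σ} = nf⇒hasNf nf-𝐑 , λ s cs →
  hasNf-·₁ nf-𝐑₁ (reify-nat cs) , λ q cq →
  hasNf-·₂ nf-𝐑₂ (reify-nat cs) (reify σ cq) , 𝐑-computable-· cs q cq

computable : (t : Tm σ) → Computable σ t
computable (var σ _) = reflect σ ε ne-var
computable 𝟘         = zero ε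
computable 𝐒         = 𝐒-computable
computable (𝐑 _)     = 𝐑-computable
computable (𝚷 _ _)   = 𝚷-computable
computable (𝚺 _ _ _) = 𝚺-computable
computable (𝔰 _)     = 𝔰-computable
computable (∪ _)     = ∪-computable
computable (⋃ _ _)   = ⋃-computable
computable (f · a)   = computable-· (computable f) (computable a)

normalise : (t : Tm σ) → HasNf t
normalise {σ} t = reify σ (computable t)

infix 4 _⇛_ _⇶_
data _⇛_ : Tm σ → Tm σ → Set
data _⇶_ : Tm σ → Tm σ → Set

data _⇛_ where
  var  : ∀ {x} → var σ x ⇛ var σ x
  𝟘    : 𝟘 ⇛ 𝟘
  𝐒    : 𝐒 ⇛ 𝐒
  𝐑    : 𝐑 σ ⇛ 𝐑 σ
  𝚷    : 𝚷 σ τ ⇛ 𝚷 σ τ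
  𝚺    : 𝚺 ρ σ τ ⇛ 𝚺 ρ σ τ
  𝔰    : 𝔰 σ ⇛ 𝔰 σ
  ∪    : ∪ σ ⇛ ∪ σ
  ⋃    : ⋃ σ τ ⇛ ⋃ σ τ
  _·_  : f ⇛ f' → a ⇛ a' → f · a ⇛ f' · a'
  here : t ⇶ u → t ⇛ u

data _⇶_ where
  conv-Σ  : {t t' : Tm (ρ ⇒ σ ⇒ τ)} {q q' : Tm (ρ ⇒ σ)} {r r' : Tm ρ} →
            t ⇛ t' → q ⇛ q' → r ⇛ r' → 𝚺 ρ σ τ · t · q · r ⇶ t' · r' · (q' · r')
  conv-Π  : {t t' : Tm σ} {q : Tm τ} → t ⇛ t' → 𝚷 σ τ · t · q ⇶ t'
  conv-⋃s : {t t' : Tm σ} {q q' : Tm (σ ⇒ τ *)} →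
            t ⇛ t' → q ⇛ q' → ⋃ σ τ · (𝔰 σ · t) · q ⇶ q' · t'
  conv-⋃∪ : {t t' q q' : Tm (σ *)} {r r' : Tm (σ ⇒ τ *)} → t ⇛ t' → q ⇛ q' → r ⇛ r' →
            ⋃ σ τ · (∪ σ · t · q) · r ⇶ ∪ τ · (⋃ σ τ · t' · r') · (⋃ σ τ · q' · r')
  conv-R0 : {q q' : Tm σ} {r : Tm (σ ⇒ N ⇒ σ)} → q ⇛ q' → 𝐑 σ · 𝟘 · q · r ⇶ q'
  conv-RS : {t t' : Tm N} {q q' : Tm σ} {r r' : Tm (σ ⇒ N ⇒ σ)} → t ⇛ t' → q ⇛ q' → r ⇛ r' →
            𝐑 σ · (𝐒 · t) · q · r ⇶ r' · (𝐑 σ · t' · q' · r') · t'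

⇛-refl : (t : Tm σ) → t ⇛ t
⇛-refl (var _ _) = var
⇛-refl 𝟘         = 𝟘
⇛-refl 𝐒         = 𝐒
⇛-refl (𝐑 _)     = 𝐑
⇛-refl (𝚷 _ _)   = 𝚷
⇛-refl (𝚺 _ _ _) = 𝚺
⇛-refl (𝔰 _)     = 𝔰
⇛-refl (∪ _)     = ∪
⇛-refl (⋃ _ _)   = ⋃
⇛-refl (f · a)   = ⇛-refl f · ⇛-refl a

⇝⇒⇶ : t ⇝ u → t ⇶ u
⇝⇒⇶ (conv-Σ t q r)  = conv-Σ (⇛-refl t) (⇛-refl q) (⇛-refl r)
⇝⇒⇶ (conv-Π t _)    = conv-Π (⇛-refl t)
⇝⇒⇶ (conv-⋃s t q)   = conv-⋃s (⇛-refl t) (⇛-refl q)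
⇝⇒⇶ (conv-⋃∪ t q r) = conv-⋃∪ (⇛-refl t) (⇛-refl q) (⇛-refl r)
⇝⇒⇶ (conv-R0 q _)   = conv-R0 (⇛-refl q)
⇝⇒⇶ (conv-RS t q r) = conv-RS (⇛-refl t) (⇛-refl q) (⇛-refl r)

⟶⇒⇛ : t ⟶ u → t ⇛ u
⟶⇒⇛ (here c)      = here (⇝⇒⇶ c)
⟶⇒⇛ (appˡ a f⟶f') = ⟶⇒⇛ f⟶f' · ⇛-refl a
⟶⇒⇛ (appʳ f a⟶a') = ⇛-refl f · ⟶⇒⇛ a⟶a'

⇛⇒⟶* : t ⇛ u → t ⟶* u
⇶⇒⟶* : t ⇶ u → t ⟶* u

⇛⇒⟶* var      = ε
⇛⇒⟶* 𝟘        = ε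
⇛⇒⟶* 𝐒        = ε
⇛⇒⟶* 𝐑        = ε
⇛⇒⟶* 𝚷        = ε
⇛⇒⟶* 𝚺        = ε
⇛⇒⟶* 𝔰        = ε
⇛⇒⟶* ∪        = ε
⇛⇒⟶* ⋃        = ε
⇛⇒⟶* (f · a)  = ·-cong (⇛⇒⟶* f) (⇛⇒⟶* a)
⇛⇒⟶* (here c) = ⇶⇒⟶* c

⇶⇒⟶* (conv-Σ t q r)  =
  ·-cong (·-cong (·-congʳ _ (⇛⇒⟶* t)) (⇛⇒⟶* q)) (⇛⇒⟶* r) ◅◅ contract (conv-Σ _ _ _)
⇶⇒⟶* (conv-Π t)      = ·-congˡ _ (·-congʳ _ (⇛⇒⟶* t)) ◅◅ contract (conv-Π _ _)
⇶⇒⟶* (conv-⋃s t q)   = ·-cong (·-congʳ _ (·-congʳ _ (⇛⇒⟶* t))) (⇛⇒⟶* q) ◅◅ contract (conv-⋃s _ _)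
⇶⇒⟶* (conv-⋃∪ t q r) =
  ·-cong (·-congʳ _ (·-cong (·-congʳ _ (⇛⇒⟶* t)) (⇛⇒⟶* q))) (⇛⇒⟶* r) ◅◅ contract (conv-⋃∪ _ _ _)
⇶⇒⟶* (conv-R0 q)     = ·-congˡ _ (·-congʳ _ (⇛⇒⟶* q)) ◅◅ contract (conv-R0 _ _)
⇶⇒⟶* (conv-RS t q r) =
  ·-cong (·-cong (·-congʳ _ (·-congʳ _ (⇛⇒⟶* t))) (⇛⇒⟶* q)) (⇛⇒⟶* r) ◅◅ contract (conv-RS _ _ _)

⇛-diamond : t ⇛ u → t ⇛ v → ∃ λ w → u ⇛ w × v ⇛ w
⇶-diamond : t ⇶ u → t ⇛ v → ∃ λ w → u ⇛ w × v ⇛ w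

⇛-diamond var var = _ , var , var
⇛-diamond 𝟘   𝟘   = _ , 𝟘 , 𝟘
⇛-diamond 𝐒   𝐒   = _ , 𝐒 , 𝐒
⇛-diamond 𝐑   𝐑   = _ , 𝐑 , 𝐑
⇛-diamond 𝚷   𝚷   = _ , 𝚷 , 𝚷
⇛-diamond 𝚺   𝚺   = _ , 𝚺 , 𝚺
⇛-diamond 𝔰   𝔰   = _ , 𝔰 , 𝔰
⇛-diamond ∪   ∪   = _ , ∪ , ∪
⇛-diamond ⋃   ⋃   = _ , ⋃ , ⋃
⇛-diamond (f · a) (f' · a') =
  let (_ , f₁ , f₂) = ⇛-diamond f f' ; (_ , a₁ , a₂) = ⇛-diamond a a' in _ , f₁ · a₁ , f₂ · a₂
⇛-diamond (here c) d = ⇶-diamond c d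
⇛-diamond d (here c) = let (w , d₁ , d₂) = ⇶-diamond c d in w , d₂ , d₁

-- The conversions do not overlap, so a contraction only competes with parallel steps inside
-- the same redex.
⇶-diamond (conv-Σ t q r) (here (conv-Σ t' q' r')) =
  let (_ , t₁ , t₂) = ⇛-diamond t t' ; (_ , q₁ , q₂) = ⇛-diamond q q' ; (_ , r₁ , r₂) = ⇛-diamond r r'
  in _ , t₁ · r₁ · (q₁ · r₁) , t₂ · r₂ · (q₂ · r₂)
⇶-diamond (conv-Σ t q r) (𝚺 · t' · q' · r') =
  let (_ , t₁ , t₂) = ⇛-diamond t t' ; (_ , q₁ , q₂) = ⇛-diamond q q' ; (_ , r₁ , r₂) = ⇛-diamond r r'
  in _ , t₁ · r₁ · (q₁ · r₁) , here (conv-Σ t₂ q₂ r₂)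
⇶-diamond (conv-Π t) (here (conv-Π t')) = ⇛-diamond t t'
⇶-diamond (conv-Π t) (𝚷 · t' · _) =
  let (_ , t₁ , t₂) = ⇛-diamond t t' in _ , t₁ , here (conv-Π t₂)
⇶-diamond (conv-⋃s t q) (here (conv-⋃s t' q')) =
  let (_ , t₁ , t₂) = ⇛-diamond t t' ; (_ , q₁ , q₂) = ⇛-diamond q q'
  in _ , q₁ · t₁ , q₂ · t₂
⇶-diamond (conv-⋃s t q) (⋃ · (𝔰 · t') · q') =
  let (_ , t₁ , t₂) = ⇛-diamond t t' ; (_ , q₁ , q₂) = ⇛-diamond q q'
  in _ , q₁ · t₁ , here (conv-⋃s t₂ q₂)
⇶-diamond (conv-⋃∪ t q r) (here (conv-⋃∪ t' q' r')) =
  let (_ , t₁ , t₂) = ⇛-diamond t t' ; (_ , q₁ , q₂) = ⇛-diamond q q' ; (_ , r₁ , r₂) = ⇛-diamond r r'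
  in _ , ∪ · (⋃ · t₁ · r₁) · (⋃ · q₁ · r₁) , ∪ · (⋃ · t₂ · r₂) · (⋃ · q₂ · r₂)
⇶-diamond (conv-⋃∪ t q r) (⋃ · (∪ · t' · q') · r') =
  let (_ , t₁ , t₂) = ⇛-diamond t t' ; (_ , q₁ , q₂) = ⇛-diamond q q' ; (_ , r₁ , r₂) = ⇛-diamond r r'
  in _ , ∪ · (⋃ · t₁ · r₁) · (⋃ · q₁ · r₁) , here (conv-⋃∪ t₂ q₂ r₂)
⇶-diamond (conv-R0 q) (here (conv-R0 q')) = ⇛-diamond q q'
⇶-diamond (conv-R0 q) (𝐑 · 𝟘 · q' · _) =
  let (_ , q₁ , q₂) = ⇛-diamond q q' in _ , q₁ , here (conv-R0 q₂)
⇶-diamond (conv-RS t q r) (here (conv-RS t' q' r')) =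
  let (_ , t₁ , t₂) = ⇛-diamond t t' ; (_ , q₁ , q₂) = ⇛-diamond q q' ; (_ , r₁ , r₂) = ⇛-diamond r r'
  in _ , r₁ · (𝐑 · t₁ · q₁ · r₁) · t₁ , r₂ · (𝐑 · t₂ · q₂ · r₂) · t₂
⇶-diamond (conv-RS t q r) (𝐑 · (𝐒 · t') · q' · r') =
  let (_ , t₁ , t₂) = ⇛-diamond t t' ; (_ , q₁ , q₂) = ⇛-diamond q q' ; (_ , r₁ , r₂) = ⇛-diamond r r'
  in _ , r₁ · (𝐑 · t₁ · q₁ · r₁) · t₁ , here (conv-RS t₂ q₂ r₂)

⟶-confluent : Confluent (_⟶_ {σ})
⟶-confluent = sandwiched-confluent ⟶⇒⇛ ⇛⇒⟶* (diamond⇒confluent ⇛-diamond)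

normal-⟶*-≡ : Normal n → n ⟶* w → n ≡ w
normal-⟶*-≡ _        ε       = refl
normal-⟶*-≡ n-normal (s ◅ _) = contradiction s (n-normal _)

normal-form-unique : IsNormalFormOf n₁ t → IsNormalFormOf n₂ t → n₁ ≡ n₂
normal-form-unique (t⟶*n₁ , n₁-normal) (t⟶*n₂ , n₂-normal) =
  let (w , n₁⟶*w , n₂⟶*w) = ⟶-confluent t⟶*n₁ t⟶*n₂
  in trans (normal-⟶*-≡ n₁-normal n₁⟶*w) (sym (normal-⟶*-≡ n₂-normal n₂⟶*w))

normal-form : (t : Tm σ) → Σ (Tm σ) λ n → IsNormalFormOf n t
normal-form t = let (n , t⟶*n , n-nf) = normalise t in n , t⟶*n , nf-normal n-nf

theorem9 : {σ : Ty} (t : Tm σ) →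
    Σ (Tm σ) (λ n → IsNormalFormOf n t)
    × (∀ n₁ n₂ → IsNormalFormOf n₁ t → IsNormalFormOf n₂ t → n₁ ≡ n₂)
theorem9 t = normal-form t , λ _ _ → normal-form-unique
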